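{- Let $\beta=\epsilon_i-\delta_j$ with $i\in[n]$, $j\in[m]$. Suppose $\lambda\in X$ satisfies $\lambda_1=m$, $\lambda\in X_\beta$, and $\overline{\lambda}\in X_{\nu\beta}$. Then $t_\beta(\lambda)$ has first part equal to $m$, and $\overline{t_\beta(\lambda)}=t_{\nu\beta}(\overline{\lambda})$.
   Context: Fix positive integers $m>n$. $\mathbf R$ is the grid with $n$ rows indexed top to bottom by $\epsilon_1,\dots,\epsilon_n$ and $m$ columns left to right by $\delta_1,\dots,\delta_m$, box $\epsilon_i-\delta_j$ in row $\epsilon_i$, column $\delta_j$. $X$ is the set of partitions $\lambda=(\lambda_1\ge\dots\ge\lambda_n\ge0)$ with $\lambda_1\le m$, drawn with $\lambda_k$ left-justified boxes in row $\epsilon_{n+1-k}$. For $\lambda$ with $\lambda_1=m$, $\overline\lambda=(\lambda_2,\dots,\lambda_n,0)$. $X_\gamma$ is the set of $\lambda\in X$ for which box $\gamma$ is an outer corner (a box not in $\lambda$ whose addition gives a Young diagram of a partition in $X$), and $t_\gamma:X_\gamma\to X$ adds that box. $\nu(\epsilon_i-\delta_j)=\epsilon_{i+1}-\delta_j$ for $i<n$ and $\nu(\epsilon_n-\delta_j)=\epsilon_1-\delta_j$. -}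

module Defs where

open import Data.Nat using (ℕ; zero; suc; _≤_; _<_; _<?_)
open import Data.Fin using (Fin; zero; suc; toℕ; fromℕ<; opposite)
import Data.Fin as F
open import Data.Product using (Σ; _×_; _,_)
open import Data.Sum using (_⊎_)
open import Data.Vec.Functional using (updateAt)
open import Relation.Nullary using (¬_; yes; no)
open import Relation.Binary.PropositionalEquality using (_≡_)
open import Function.Bundles using (_⇔_)

-- A partition with (at most) n parts is a function  Fin n → ℕ ;
-- index k (0-based) stands for the part λ_{k+1}.
Parts : ℕ → Set
Parts n = Fin n → ℕ

-- λ ∈ X : λ_1 ≥ … ≥ λ_n ≥ 0 and λ_1 ≤ m (stated as: every part ≤ m).
InX : ∀ {n} → ℕ → Parts n → Set
InX {n} m lam = (∀ (k l : Fin n) → k F.≤ l → lam l ≤ lam k) × (∀ k → lam k ≤ m)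

-- first part λ_1 (0 when n = 0, which does not occur since n ≥ 1)
firstPart : ∀ {n} → Parts n → ℕ
firstPart {zero} lam = 0
firstPart {suc n} lam = lam zero

-- λ̄ = (λ_2, …, λ_n, 0)
shiftIn : ∀ {n} → Parts (suc n) → Parts (suc n)
shiftIn {zero} lam zero = 0
shiftIn {suc n} lam zero = lam (suc zero)
shiftIn {suc n} lam (suc k) = shiftIn {n} (λ x → lam (suc x)) k

bar : ∀ {n} → Parts n → Parts n
bar {zero} lam = lam
bar {suc n} lam = shiftIn lam

-- Boxes of the grid R: (i , j) 0-based stands for ε_{i+1} − δ_{j+1}
-- (row i+1 from the top, column j+1 from the left).
Box : ℕ → ℕ → Set
Box n m = Fin n × Fin m

-- Row ε_{i+1} contains λ_k boxes with n+1-k = i+1, i.e. part index (0-based)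
-- opposite i = n-1-i.  Box (i , j) lies in the diagram of λ iff j+1 ≤ λ_{n-i}.
InDiagram : ∀ {n m} → Parts n → Box n m → Set
InDiagram lam (i , j) = toℕ j < lam (opposite i)

OuterCorner : ∀ {n} (m : ℕ) → Box n m → Parts n → Set
OuterCorner {n} m γ lam =
  ¬ InDiagram lam γ ×
  Σ (Parts n) (λ μ → InX m μ ×
     (∀ (b : Box n m) → InDiagram μ b ⇔ (InDiagram lam b ⊎ b ≡ γ)))

InXγ : ∀ {n} (m : ℕ) → Box n m → Parts n → Set
InXγ m γ lam = InX m lam × OuterCorner m γ lam

t : ∀ {n m} → Box n m → Parts n → Parts n
t (i , j) lam = updateAt lam (opposite i) suc

nextRow : ∀ {n} → Fin n → Fin n
nextRow {suc n} i with suc (toℕ i) <? suc n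
... | yes p = fromℕ< p
... | no _ = zero

ν : ∀ {n m} → Box n m → Box n m
ν (i , j) = (nextRow i , j)

-- Since λ₁ = m fills the bottom row ε_n, the missing box β lies in a higher row, so t_β
-- raises some part λ_{p+1} with p ≥ 1 and leaves λ₁ alone.  Dropping the first part moves
-- λ_{p+1} to position p, whose row is exactly the one below β, i.e. the row of νβ.
module Submission where

open import Defs
open import Data.Nat using (ℕ; zero; suc; _≤_; _<_; _<?_; s≤s)
open import Data.Fin using (Fin; zero; suc; toℕ; inject₁; opposite)
open import Data.Fin.Properties using (toℕ<n; toℕ-inject₁; toℕ-fromℕ<; toℕ-injective; opposite-involutive)
open import Data.Vec.Functional using (updateAt)
open import Data.Product using (_×_; _,_)
open import Function using (_∘_)
open import Relation.Nullary using (yes; no; contradiction)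
open import Relation.Binary.PropositionalEquality
  using (_≡_; refl; sym; trans; cong; subst; module ≡-Reasoning)

shiftIn-cong-tail : ∀ {n} {lam lam′ : Parts (suc n)} →
  (∀ x → lam (suc x) ≡ lam′ (suc x)) → ∀ x → shiftIn lam x ≡ shiftIn lam′ x
shiftIn-cong-tail {zero}  eq zero    = refl
shiftIn-cong-tail {suc n} eq zero    = eq zero
shiftIn-cong-tail {suc n} eq (suc x) = shiftIn-cong-tail (λ y → eq (suc y)) x

shiftIn-updateAt-suc : ∀ {n} (lam : Parts (suc n)) (k : Fin n) (f : ℕ → ℕ) →
  ∀ x → shiftIn (updateAt lam (suc k) f) x ≡ updateAt (shiftIn lam) (inject₁ k) f x
shiftIn-updateAt-suc {suc n} lam zero    f zero    = refl
shiftIn-updateAt-suc {suc n} lam zero    f (suc x) = shiftIn-cong-tail (λ _ → refl) x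
shiftIn-updateAt-suc {suc n} lam (suc k) f zero    = refl
shiftIn-updateAt-suc {suc n} lam (suc k) f (suc x) =
  shiftIn-updateAt-suc (λ y → lam (suc y)) k f x

nextRow-inject₁ : ∀ {n} (i : Fin n) → nextRow (inject₁ i) ≡ suc i
nextRow-inject₁ {n} i with suc (toℕ (inject₁ i)) <? suc n
... | yes i<n = toℕ-injective (trans (toℕ-fromℕ< i<n) (cong suc (toℕ-inject₁ i)))
... | no  i≮n = contradiction (s≤s (subst (_< n) (sym (toℕ-inject₁ i)) (toℕ<n i))) i≮n

opposite-nextRow : ∀ {n} (i : Fin (suc n)) (k : Fin n) →
  opposite i ≡ suc k → opposite (nextRow i) ≡ inject₁ k
opposite-nextRow i k opp≡ = begin
  opposite (nextRow i)                       ≡⟨ cong (opposite ∘ nextRow) i≡ ⟩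
  opposite (nextRow (inject₁ (opposite k)))  ≡⟨ cong opposite (nextRow-inject₁ (opposite k)) ⟩
  inject₁ (opposite (opposite k))            ≡⟨ cong inject₁ (opposite-involutive k) ⟩
  inject₁ k                                  ∎
  where
  open ≡-Reasoning
  i≡ : i ≡ inject₁ (opposite k)
  i≡ = trans (sym (opposite-involutive i)) (cong opposite opp≡)

lemma3p4 : (n m : ℕ) → 1 ≤ n → n < m →
    (β : Box n m) (lam : Parts n) →
    InX m lam → firstPart lam ≡ m →
    InXγ m β lam → InXγ m (ν β) (bar lam) →
    firstPart (t β lam) ≡ m × (∀ (k : Fin n) → bar (t β lam) k ≡ t (ν β) (bar lam) k)
lemma3p4 (suc n) m _ _ (i , j) lam _ λ₁≡m (_ , β∉λ , _) _ with opposite i in opp≡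
... | zero  = contradiction (subst (toℕ j <_) (sym λ₁≡m) (toℕ<n j)) β∉λ
... | suc k = λ₁≡m , λ x →
  trans (shiftIn-updateAt-suc lam k suc x)
        (cong (λ p → updateAt (shiftIn lam) p suc x) (sym (opposite-nextRow i k opp≡)))
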